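{- Let $\mathbf{H}=(H,\cdot,\to,\wedge,\vee,1)$ be a prelinear semihoop, let $\hat{\mathbf{H}}=(H,\cdot,\wedge,\vee,1)$ be its $\ell$-monoid reduct, let $\mathbf{K}(\hat{\mathbf{H}})$ be the abelian $\ell$-group and $h:H\to K(\hat H)$, $h(x)=[x\cdot x,x]$, the map described in the context. Then $h$ is an $\ell$-monoid homomorphism, and $h$ is injective if and only if the monoid $(H,\cdot,1)$ is cancellative. Furthermore, letting $\mathbf{J}_{h[H]}$ be the $\ell$-subgroup of $\mathbf{K}(\hat{\mathbf{H}})$ generated by $h[H]=\{h(a)\mid a\in H\}$, for every $x\in K(\hat H)$ there exists $y\in J_{h[H]}$ with $y\le x$, and there exists $y'\in J_{h[H]}$ with $y'\ge x$.
   Context: A semihoop is an algebra $(H,\cdot,\to,\wedge,1)$ such that $(H,\wedge,1)$ is a meet-semilattice with top $1$; $(H,\cdot,1)$ is a commutative monoid that is isotone w.r.t. the semilattice order; $c_1\le c_2$ iff $c_1\to c_2=1$; and $(c_1\cdot c_2)\to c_3=c_1\to(c_2\to c_3)$. It is prelinear if $(x\to y)\to z\le((y\to x)\to z)\to z$. In a prelinear semihoop $x\vee y:=((x\to y)\to y)\wedge((y\to x)\to x)$ is the lattice join, and $(H,\cdot,\wedge,\vee,1)$ is an $\ell$-monoid (multiplicative notation: $\cdot$ distributes over $\wedge$ and $\vee$). Construction of $\mathbf{K}(\hat{\mathbf{H}})$: on $H\times H$ put $(x,y)\sim(x',y')$ iff there is $z\in H$ with $z\cdot x\cdot y'=z\cdot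 x'\cdot y$; $K(\hat H)=H\times H/\sim$ with classes $[x,y]$; group operation $[x,y]+[x',y']=[x\cdot x',y\cdot y']$, neutral element $[1,1]$, inverse $-[x,y]=[y,x]$; order $[x_1,y_1]\le[x_2,y_2]$ iff there is $z\in H$ with $z\cdot x_1\cdot y_2\le z\cdot y_1\cdot x_2$; lattice operations $[x_1,y_1]\sqcup[x_2,y_2]=[x_1\cdot x_2,(x_1\cdot y_2)\wedge(x_2\cdot y_1)]$ and $[x_1,y_1]\sqcap[x_2,y_2]=[(x_1\cdot y_2)\wedge(x_2\cdot y_1),y_1\cdot y_2]$. This makes $\mathbf{K}(\hat{\mathbf{H}})$ an abelian $\ell$-group. -}

module Defs where

open import Level using (Level; _⊔_) renaming (suc to lsuc)
open import Relation.Binary.PropositionalEquality using (_≡_)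
open import Data.Product using (_×_; _,_; proj₁; proj₂; Σ; ∃)

record PrelinearSemihoop (a : Level) : Set (lsuc a) where
  infixl 7 _·_
  infixr 5 _⇒_
  infixl 6 _∧_
  infix 4 _≤_
  field
    Carrier : Set a
    _·_ : Carrier → Carrier → Carrier
    _⇒_ : Carrier → Carrier → Carrier
    _∧_ : Carrier → Carrier → Carrier
    1#  : Carrier
  _≤_ : Carrier → Carrier → Set a
  x ≤ y = x ∧ y ≡ x
  field
    ∧-assoc : ∀ x y z → (x ∧ y) ∧ z ≡ x ∧ (y ∧ z)
    ∧-comm  : ∀ x y → x ∧ y ≡ y ∧ x
    ∧-idem  : ∀ x → x ∧ x ≡ x
    ∧-top   : ∀ x → x ∧ 1# ≡ x
    ·-assoc : ∀ x y z → (x · y) · z ≡ x · (y · z)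
    ·-comm  : ∀ x y → x · y ≡ y · x
    ·-identityˡ : ∀ x → 1# · x ≡ x
    ·-isotone : ∀ x y z → x ≤ y → x · z ≤ y · z
    ≤⇒⇒≡1 : ∀ x y → x ≤ y → x ⇒ y ≡ 1#
    ⇒≡1⇒≤ : ∀ x y → x ⇒ y ≡ 1# → x ≤ y
    ·-curry : ∀ x y z → (x · y) ⇒ z ≡ x ⇒ (y ⇒ z)
    prelinear : ∀ x y z → (x ⇒ y) ⇒ z ≤ ((y ⇒ x) ⇒ z) ⇒ z

  infixl 6 _∨_
  _∨_ : Carrier → Carrier → Carrier
  x ∨ y = ((x ⇒ y) ⇒ y) ∧ ((y ⇒ x) ⇒ x)

  Cancellative : Set a
  Cancellative = ∀ x y z → x · z ≡ y · z → x ≡ y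

-- The construction K(Ĥ): elements are pairs (x , y) representing classes [x , y];
-- equality of classes is the relation ∼, so K is a setoid rather than a quotient type.
module K {a : Level} (H : PrelinearSemihoop a) where
  open PrelinearSemihoop H

  KPair : Set a
  KPair = Carrier × Carrier

  infix 4 _∼_ _⊑_
  _∼_ : KPair → KPair → Set a
  (x , y) ∼ (x' , y') = ∃ λ z → z · x · y' ≡ z · x' · y

  _⊑_ : KPair → KPair → Set a
  (x₁ , y₁) ⊑ (x₂ , y₂) = ∃ λ z → z · x₁ · y₂ ≤ z · y₁ · x₂

  infixl 6 _+K_
  _+K_ : KPair → KPair → KPair
  (x , y) +K (x' , y') = (x · x' , y · y')

  0K : KPair
  0K = (1# , 1#)

  -K_ : KPair → KPair
  -K (x , y) = (y , x)

  _⊔K_ : KPair → KPair → KPair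
  (x₁ , y₁) ⊔K (x₂ , y₂) = (x₁ · x₂ , (x₁ · y₂) ∧ (x₂ · y₁))

  _⊓K_ : KPair → KPair → KPair
  (x₁ , y₁) ⊓K (x₂ , y₂) = ((x₁ · y₂) ∧ (x₂ · y₁) , y₁ · y₂)

  h : Carrier → KPair
  h x = (x · x , x)

  IsℓMonoidHom : Set a
  IsℓMonoidHom =
      (∀ x y → h (x · y) ∼ h x +K h y)
    × (∀ x y → h (x ∧ y) ∼ h x ⊓K h y)
    × (∀ x y → h (x ∨ y) ∼ h x ⊔K h y)
    × (h 1# ∼ 0K)

  hInjective : Set a
  hInjective = ∀ x y → h x ∼ h y → x ≡ y

  -- J_{h[H]}: the ℓ-subgroup generated by h[H], as the least subset of K(Ĥ)
  -- containing h[H], closed under 0, +, -, ⊔, ⊓ and under ∼ (membership of classes).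
  data J : KPair → Set a where
    J-gen  : ∀ x → J (h x)
    J-0    : J 0K
    J-+    : ∀ {u v} → J u → J v → J (u +K v)
    J-neg  : ∀ {u} → J u → J (-K u)
    J-⊔    : ∀ {u v} → J u → J v → J (u ⊔K v)
    J-⊓    : ∀ {u v} → J u → J v → J (u ⊓K v)
    J-∼    : ∀ {u v} → u ∼ v → J u → J v

module Submission where

-- Proof outline.
-- (1) Order theory of a prelinear semihoop: residuation (x · y ≤ z iff x ≤ y ⇒ z),
--     isotonicity of ·, and the prelinear case split: if both (a ⇒ b) · u ≤ v and
--     (b ⇒ a) · u ≤ v, then u ≤ v.
-- (2) By the case split, · distributes over ∧, and (x ∨ y) · (x ∧ y) = x · y.
-- (3) Every equation  x · y' = x' · y  in H gives [x , y] ∼ [x' , y'] (witness 1).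
--     With (2) this yields the homomorphism laws for h(x) = [x · x , x]:
--     the meet law uses  x·x·y ∧ y·y·x = x·y·(x ∧ y), the join law additionally
--     uses (x ∨ y) · (x ∧ y) = x · y.
-- (4) h x ∼ h y unfolds to  z·x·x·y = z·y·y·x, i.e. x·(zxy) = y·(zxy), so injectivity
--     of h is exactly cancellativity.
-- (5) Every class satisfies [p , q] ∼ h p − h q, so J_{h[H]} is all of K(Ĥ) (a
--     stronger fact than the bound statement); the required lower and upper
--     bounds of x in J are then x itself, by reflexivity of ⊑.

open import Defs
open import Level using (Level)
open import Data.Product using (_×_; ∃; _,_)
open import Function.Bundles using (_⇔_; mk⇔; Equivalence)
open import Relation.Binary.PropositionalEquality
  using (_≡_; refl; sym; trans; cong; cong₂; subst; subst₂; isEquivalence; module ≡-Reasoning)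
open import Algebra.Bundles using (CommutativeMonoid)
import Algebra.Solver.CommutativeMonoid as CommutativeMonoidSolver

module SemihoopTheory {a : Level} (H : PrelinearSemihoop a) where
  open PrelinearSemihoop H

  ·-identityʳ : ∀ x → x · 1# ≡ x
  ·-identityʳ x = trans (·-comm x 1#) (·-identityˡ x)

  ·-commutativeMonoid : CommutativeMonoid a a
  ·-commutativeMonoid = record
    { Carrier = Carrier ; _≈_ = _≡_ ; _∙_ = _·_ ; ε = 1#
    ; isCommutativeMonoid = record
      { isMonoid = record
        { isSemigroup = record
          { isMagma = record { isEquivalence = isEquivalence ; ∙-cong = cong₂ _·_ }
          ; assoc = ·-assoc }
        ; identity = ·-identityˡ , ·-identityʳ }
      ; comm = ·-comm } }

  open CommutativeMonoidSolver ·-commutativeMonoid using (solve; _⊜_; _⊕_)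

  ≤-refl : ∀ x → x ≤ x
  ≤-refl = ∧-idem

  ≤-reflexive : ∀ {x y} → x ≡ y → x ≤ y
  ≤-reflexive {x} x≡y = subst (x ≤_) x≡y (≤-refl x)

  ≤-trans : ∀ {x y z} → x ≤ y → y ≤ z → x ≤ z
  ≤-trans {x} {y} {z} x≤y y≤z = begin
    x ∧ z        ≡⟨ cong (_∧ z) (sym x≤y) ⟩
    (x ∧ y) ∧ z  ≡⟨ ∧-assoc x y z ⟩
    x ∧ (y ∧ z)  ≡⟨ cong (x ∧_) y≤z ⟩
    x ∧ y        ≡⟨ x≤y ⟩
    x            ∎
    where open ≡-Reasoning

  ≤-antisym : ∀ {x y} → x ≤ y → y ≤ x → x ≡ y
  ≤-antisym {x} {y} x≤y y≤x = trans (sym x≤y) (trans (∧-comm x y) y≤x)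

  x∧y≤y : ∀ x y → x ∧ y ≤ y
  x∧y≤y x y = trans (∧-assoc x y y) (cong (x ∧_) (∧-idem y))

  x∧y≤x : ∀ x y → x ∧ y ≤ x
  x∧y≤x x y = subst (_≤ x) (∧-comm y x) (x∧y≤y y x)

  ∧-greatest : ∀ {t x y} → t ≤ x → t ≤ y → t ≤ x ∧ y
  ∧-greatest {t} {x} {y} t≤x t≤y = trans (sym (∧-assoc t x y)) (trans (cong (_∧ y) t≤x) t≤y)

  residual : ∀ {x y z} → x · y ≤ z → x ≤ y ⇒ z
  residual {x} {y} {z} xy≤z = ⇒≡1⇒≤ x (y ⇒ z) (trans (sym (·-curry x y z)) (≤⇒⇒≡1 _ _ xy≤z))

  residual⁻ : ∀ {x y z} → x ≤ y ⇒ z → x · y ≤ z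
  residual⁻ {x} {y} {z} x≤y⇒z = ⇒≡1⇒≤ (x · y) z (trans (·-curry x y z) (≤⇒⇒≡1 _ _ x≤y⇒z))

  modus-ponens : ∀ y z → (y ⇒ z) · y ≤ z
  modus-ponens y z = residual⁻ (≤-refl _)

  modus-ponens′ : ∀ y z → y · (y ⇒ z) ≤ z
  modus-ponens′ y z = subst (_≤ z) (·-comm _ _) (modus-ponens y z)

  ·-monoʳ : ∀ {x y} z → x ≤ y → z · x ≤ z · y
  ·-monoʳ {x} {y} z x≤y = subst₂ _≤_ (·-comm x z) (·-comm y z) (·-isotone x y z x≤y)

  ·-mono : ∀ {x x' y y'} → x ≤ x' → y ≤ y' → x · y ≤ x' · y'
  ·-mono {x} {x'} {y} x≤x' y≤y' = ≤-trans (·-isotone x x' y x≤x') (·-monoʳ x' y≤y')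

  x·y≤y : ∀ x y → x · y ≤ y
  x·y≤y x y = subst (x · y ≤_) (·-identityˡ y) (·-isotone x 1# y (∧-top x))

  x·y≤x : ∀ x y → x · y ≤ x
  x·y≤x x y = subst (_≤ x) (·-comm y x) (x·y≤y y x)

  -- Prelinear case split: to prove u ≤ v it suffices to prove it "under" a ⇒ b
  -- and "under" b ⇒ a. This is the only place prelinearity is used.
  prelinear-cases : ∀ a b {u v} → (a ⇒ b) · u ≤ v → (b ⇒ a) · u ≤ v → u ≤ v
  prelinear-cases a b {u} {v} case-ab case-ba =
    subst (_≤ v) (·-identityˡ u) (residual⁻ 1≤u⇒v)
    where
    1≤1⇒u⇒v : 1# ≤ 1# ⇒ (u ⇒ v)
    1≤1⇒u⇒v = subst₂ (λ s t → s ≤ t ⇒ (u ⇒ v))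
      (≤⇒⇒≡1 _ _ (residual case-ab)) (≤⇒⇒≡1 _ _ (residual case-ba))
      (prelinear a b (u ⇒ v))
    1≤u⇒v : 1# ≤ u ⇒ v
    1≤u⇒v = subst (_≤ u ⇒ v) (·-identityˡ 1#) (residual⁻ 1≤1⇒u⇒v)

  ⇒-meet : ∀ y z → (y ⇒ z) · y ≤ y ∧ z
  ⇒-meet y z = ∧-greatest (x·y≤y _ y) (modus-ponens y z)

  ·-distribˡ-∧ : ∀ x y z → x · (y ∧ z) ≡ (x · y) ∧ (x · z)
  ·-distribˡ-∧ x y z = ≤-antisym
    (∧-greatest (·-monoʳ x (x∧y≤x y z)) (·-monoʳ x (x∧y≤y y z)))
    (prelinear-cases y z under-y⇒z under-z⇒y)
    where
    swap : ∀ i u w → i · (u · w) ≡ u · (i · w)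
    swap = solve 3 (λ i u w → i ⊕ (u ⊕ w) ⊜ u ⊕ (i ⊕ w)) refl
    under-y⇒z : (y ⇒ z) · ((x · y) ∧ (x · z)) ≤ x · (y ∧ z)
    under-y⇒z = ≤-trans (·-monoʳ (y ⇒ z) (x∧y≤x (x · y) (x · z)))
      (subst (_≤ x · (y ∧ z)) (sym (swap (y ⇒ z) x y)) (·-monoʳ x (⇒-meet y z)))
    under-z⇒y : (z ⇒ y) · ((x · y) ∧ (x · z)) ≤ x · (y ∧ z)
    under-z⇒y = ≤-trans (·-monoʳ (z ⇒ y) (x∧y≤y (x · y) (x · z)))
      (subst₂ _≤_ (sym (swap (z ⇒ y) x z)) (cong (x ·_) (∧-comm z y))
        (·-monoʳ x (⇒-meet z y)))

  x≤x∨y : ∀ x y → x ≤ x ∨ y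
  x≤x∨y x y = ∧-greatest (residual (modus-ponens′ x y)) (residual (x·y≤x x (y ⇒ x)))

  y≤x∨y : ∀ x y → y ≤ x ∨ y
  y≤x∨y x y = ∧-greatest (residual (x·y≤x y (x ⇒ y))) (residual (modus-ponens′ y x))

  ⇒-join₁ : ∀ x y → (x ⇒ y) · (x ∨ y) ≤ y
  ⇒-join₁ x y = subst (_≤ y) (·-comm _ _) (residual⁻ (x∧y≤x ((x ⇒ y) ⇒ y) ((y ⇒ x) ⇒ x)))

  ⇒-join₂ : ∀ x y → (y ⇒ x) · (x ∨ y) ≤ x
  ⇒-join₂ x y = subst (_≤ x) (·-comm _ _) (residual⁻ (x∧y≤y ((x ⇒ y) ⇒ y) ((y ⇒ x) ⇒ x)))

  join·meet : ∀ x y → (x ∨ y) · (x ∧ y) ≡ x · y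
  join·meet x y = ≤-antisym
    (prelinear-cases x y
      (subst₂ _≤_ (·-assoc _ _ _) (·-comm y x) (·-mono (⇒-join₁ x y) (x∧y≤x x y)))
      (subst (_≤ x · y) (·-assoc _ _ _) (·-mono (⇒-join₂ x y) (x∧y≤y x y))))
    (prelinear-cases x y
      (subst (_≤ (x ∨ y) · (x ∧ y)) (rearrange₁ (x ⇒ y) x y)
        (·-mono (y≤x∨y x y) (∧-greatest (x·y≤x x (x ⇒ y)) (modus-ponens′ x y))))
      (subst (_≤ (x ∨ y) · (x ∧ y)) (rearrange₂ (y ⇒ x) x y)
        (·-mono (x≤x∨y x y) (∧-greatest (modus-ponens′ y x) (x·y≤x y (y ⇒ x))))))
    where
    rearrange₁ : ∀ i x y → y · (x · i) ≡ i · (x · y)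
    rearrange₁ = solve 3 (λ i x y → y ⊕ (x ⊕ i) ⊜ i ⊕ (x ⊕ y)) refl
    rearrange₂ : ∀ i x y → x · (y · i) ≡ i · (x · y)
    rearrange₂ = solve 3 (λ i x y → x ⊕ (y ⊕ i) ⊜ i ⊕ (x ⊕ y)) refl

  cross-meet : ∀ x y → ((x · x) · y) ∧ ((y · y) · x) ≡ (x · y) · (x ∧ y)
  cross-meet x y = sym (trans (·-distribˡ-∧ (x · y) x y)
    (cong₂ _∧_ (solve 2 (λ x y → (x ⊕ y) ⊕ x ⊜ (x ⊕ x) ⊕ y) refl x y)
               (solve 2 (λ x y → (x ⊕ y) ⊕ y ⊜ (y ⊕ y) ⊕ x) refl x y)))

module KTheory {a : Level} (H : PrelinearSemihoop a) where
  open PrelinearSemihoop H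
  open K H
  open SemihoopTheory H
  open CommutativeMonoidSolver ·-commutativeMonoid using (solve; _⊜_; _⊕_; id)
  open ≡-Reasoning

  ∼-intro : ∀ {x y x' y'} → x · y' ≡ x' · y → (x , y) ∼ (x' , y')
  ∼-intro {x} {y} {x'} {y'} e =
    1# , trans (cong (_· y') (·-identityˡ x)) (trans e (cong (_· y) (sym (·-identityˡ x'))))

  h-homomorphism : IsℓMonoidHom
  h-homomorphism = h-· , h-∧ , h-∨ , h-1
    where
    h-· : ∀ x y → h (x · y) ∼ h x +K h y
    h-· x y = ∼-intro (solve 2 (λ x y → ((x ⊕ y) ⊕ (x ⊕ y)) ⊕ (x ⊕ y) ⊜ ((x ⊕ x) ⊕ (y ⊕ y)) ⊕ (x ⊕ y)) refl x y)

    h-∧ : ∀ x y → h (x ∧ y) ∼ h x ⊓K h y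
    h-∧ x y = ∼-intro (begin
      ((x ∧ y) · (x ∧ y)) · (x · y)  ≡⟨ solve 3 (λ x y m → (m ⊕ m) ⊕ (x ⊕ y) ⊜ ((x ⊕ y) ⊕ m) ⊕ m) refl x y (x ∧ y) ⟩
      ((x · y) · (x ∧ y)) · (x ∧ y)  ≡⟨ cong (_· (x ∧ y)) (sym (cross-meet x y)) ⟩
      (((x · x) · y) ∧ ((y · y) · x)) · (x ∧ y)  ∎)

    h-∨ : ∀ x y → h (x ∨ y) ∼ h x ⊔K h y
    h-∨ x y = ∼-intro (begin
      ((x ∨ y) · (x ∨ y)) · (((x · x) · y) ∧ ((y · y) · x))
        ≡⟨ cong (((x ∨ y) · (x ∨ y)) ·_) (cross-meet x y) ⟩
      ((x ∨ y) · (x ∨ y)) · ((x · y) · (x ∧ y))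
        ≡⟨ solve 4 (λ x y j m → (j ⊕ j) ⊕ ((x ⊕ y) ⊕ m) ⊜ (j ⊕ (x ⊕ y)) ⊕ (j ⊕ m)) refl x y (x ∨ y) (x ∧ y) ⟩
      ((x ∨ y) · (x · y)) · ((x ∨ y) · (x ∧ y))
        ≡⟨ cong ((x ∨ y) · (x · y) ·_) (join·meet x y) ⟩
      ((x ∨ y) · (x · y)) · (x · y)
        ≡⟨ solve 3 (λ x y j → (j ⊕ (x ⊕ y)) ⊕ (x ⊕ y) ⊜ ((x ⊕ x) ⊕ (y ⊕ y)) ⊕ j) refl x y (x ∨ y) ⟩
      ((x · x) · (y · y)) · (x ∨ y)  ∎)

    h-1 : h 1# ∼ 0K
    h-1 = ∼-intro (cong (_· 1#) (·-identityˡ 1#))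

  h∼⇔common-factor : ∀ x y z →
    (z · (x · x) · y ≡ z · (y · y) · x) ⇔ (x · (z · x · y) ≡ y · (z · x · y))
  h∼⇔common-factor x y z = mk⇔
    (λ e → trans (left x y z) (trans e (sym (right x y z))))
    (λ e → trans (sym (left x y z)) (trans e (right x y z)))
    where
    left : ∀ x y z → x · (z · x · y) ≡ z · (x · x) · y
    left = solve 3 (λ x y z → x ⊕ ((z ⊕ x) ⊕ y) ⊜ (z ⊕ (x ⊕ x)) ⊕ y) refl
    right : ∀ x y z → y · (z · x · y) ≡ z · (y · y) · x
    right = solve 3 (λ x y z → y ⊕ ((z ⊕ x) ⊕ y) ⊜ (z ⊕ (y ⊕ y)) ⊕ x) refl

  h-injective⇔cancellative : hInjective ⇔ Cancellative
  h-injective⇔cancellative = mk⇔ to from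
    where
    regroup : ∀ w x y z → w · (z · x · y) ≡ (w · z) · (x · y)
    regroup = solve 4 (λ w x y z → w ⊕ ((z ⊕ x) ⊕ y) ⊜ (w ⊕ z) ⊕ (x ⊕ y)) refl
    to : hInjective → Cancellative
    to inj x y z xz≡yz = inj x y (z , Equivalence.from (h∼⇔common-factor x y z) (begin
      x · (z · x · y)    ≡⟨ regroup x x y z ⟩
      (x · z) · (x · y)  ≡⟨ cong (_· (x · y)) xz≡yz ⟩
      (y · z) · (x · y)  ≡⟨ sym (regroup y x y z) ⟩
      y · (z · x · y)    ∎))
    from : Cancellative → hInjective
    from cancel x y (z , e) = cancel x y (z · x · y) (Equivalence.to (h∼⇔common-factor x y z) e)

  difference-of-images : ∀ p q → h p +K (-K h q) ∼ (p , q)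
  difference-of-images p q =
    ∼-intro (solve 2 (λ p q → ((p ⊕ p) ⊕ q) ⊕ q ⊜ p ⊕ (p ⊕ (q ⊕ q))) refl p q)

  J-total : ∀ u → J u
  J-total (p , q) = J-∼ (difference-of-images p q) (J-+ (J-gen p) (J-neg (J-gen q)))

  ⊑-refl : ∀ u → u ⊑ u
  ⊑-refl (x , y) = 1# , ≤-reflexive (solve 2 (λ x y → (id ⊕ x) ⊕ y ⊜ (id ⊕ y) ⊕ x) refl x y)

corollary3p4 : ∀ {a : Level} (H : PrelinearSemihoop a) →
    let open PrelinearSemihoop H in
    let open K H in
      IsℓMonoidHom
    × (hInjective ⇔ Cancellative)
    × (∀ (x : KPair) → (∃ λ y → J y × y ⊑ x) × (∃ λ y' → J y' × x ⊑ y'))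
corollary3p4 H = h-homomorphism , h-injective⇔cancellative , bounds
  where
  open K H
  open KTheory H
  bounds : ∀ (x : KPair) → (∃ λ y → J y × y ⊑ x) × (∃ λ y' → J y' × x ⊑ y')
  bounds x = (x , J-total x , ⊑-refl x) , (x , J-total x , ⊑-refl x)
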